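{- Let $P$ be an mca-program over a set of atoms $\mathit{At}$ and let $M \subseteq \mathit{At}$. Then $M$ is a model of $P$ if and only if there exists $M' \in T^{\mathit{nd}}_P(M)$ such that $M' \subseteq M$.
   Context: Let $\mathit{At}$ be a set of propositional atoms. An mc-atom over $\mathit{At}$ is an expression $kX$, where $k$ is a non-negative integer and $X \subseteq \mathit{At}$ is finite with $k \leq |X|$; its atom set is $\mathit{aset}(kX) = X$. An mc-literal is an expression $A$ or $\mathbf{not}(A)$, where $A$ is an mc-atom. An mca-clause $r$ is an expression $H \leftarrow L_1, \ldots, L_m$ ($m \geq 0$), where $H$ is an mc-atom and the $L_i$ are mc-literals. It has head $\mathit{hd}(r) = H$, body $\mathit{bd}(r) = \{L_1, \ldots, L_m\}$, and head set $\mathit{hset}(r) = \mathit{aset}(H)$. An mca-program is a set of mca-clauses. For a set $Q$ of clauses, $\mathit{hset}(Q) = \bigcup\{\mathit{hset}(r) : r \in Q\}$. Satisfaction, for $M \subseteq \mathit{At}$: - $M \models kX$ iff $|M \cap X| \geq k$. - $M \models \mathbf{not}(kX)$ iff $|M \cap X| < k$. - $M \models \mathit{bd}(r)$ iff $M$ satisfies all literals in $\mathit{bd}(r)$. - $M$ satisfies a clause $r$ if $M \models \mathit{hd}(r)$ whenever $M \models \mathit{bd}(r)$. - $M$ is a model of $P$ if it satisfies every clause of $P$. Operators: - $P(M) = \{r \in P : M \models \mathit{bd}(r)\}$. - $T^{\mathit{nd}}_P(M)$ is the set of all $M'$ with $M' \subseteq \mathit{hset}(P(M))$ and $M' \models \mathit{hd}(r)$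 for all $r \in P(M)$. -}

module Defs where

open import Level using (0ℓ)
open import Data.Nat using (ℕ; _≤_)
open import Data.List using (List; length)
open import Data.List.Membership.Propositional using (_∈_)
open import Data.List.Relation.Unary.All using (All)
open import Data.List.Relation.Unary.Unique.Propositional using (Unique)
open import Data.Product using (Σ; ∃; _×_)
open import Relation.Nullary using (¬_)
open import Relation.Unary using (Pred; _⊆_)
open import Relation.Binary.PropositionalEquality using (_≡_)

-- A (possibly infinite) set of atoms is a predicate on the atom type At.
-- A finite set X ⊆ At is a duplicate-free list.

record MCAtom (At : Set) : Set where
  constructor mcatom
  field
    k     : ℕ
    X     : List At
    X-uniq : Unique X
    k≤∣X∣ : k ≤ length X

open MCAtom public

aset : {At : Set} → MCAtom At → List At
aset = X

data MCLit (At : Set) : Set where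
  pos : MCAtom At → MCLit At
  neg : MCAtom At → MCLit At

record Clause (At : Set) : Set where
  constructor _←_
  field
    hd : MCAtom At
    bd : List (MCLit At)

open Clause public

hsetᶜ : {At : Set} → Clause At → List At
hsetᶜ r = aset (hd r)

Program : Set → Set₁
Program At = Pred (Clause At) 0ℓ

hset : {At : Set} → Program At → Pred At 0ℓ
hset Q a = ∃ λ r → Q r × a ∈ hsetᶜ r

-- M ⊨ kX  iff  |M ∩ X| ≥ k, i.e. there are k distinct atoms of X lying in M
_⊨ₐ_ : {At : Set} → Pred At 0ℓ → MCAtom At → Set
_⊨ₐ_ {At} M A = ∃ λ (ys : List At) →
  Unique ys × length ys ≡ k A × All (λ y → y ∈ X A × M y) ys

_⊨ₗ_ : {At : Set} → Pred At 0ℓ → MCLit At → Set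
M ⊨ₗ pos A = M ⊨ₐ A
M ⊨ₗ neg A = ¬ (M ⊨ₐ A)

_⊨ᵇ_ : {At : Set} → Pred At 0ℓ → List (MCLit At) → Set
M ⊨ᵇ B = All (M ⊨ₗ_) B

_⊨ᶜ_ : {At : Set} → Pred At 0ℓ → Clause At → Set
M ⊨ᶜ r = M ⊨ᵇ bd r → M ⊨ₐ hd r

IsModel : {At : Set} → Program At → Pred At 0ℓ → Set
IsModel P M = ∀ r → P r → M ⊨ᶜ r

_⟨_⟩ : {At : Set} → Program At → Pred At 0ℓ → Program At
(P ⟨ M ⟩) r = P r × M ⊨ᵇ bd r

Tnd : {At : Set} → Program At → Pred At 0ℓ → Pred (Pred At 0ℓ) 0ℓ
Tnd P M M' = (M' ⊆ hset (P ⟨ M ⟩)) × (∀ r → (P ⟨ M ⟩) r → M' ⊨ₐ hd r)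

{-# OPTIONS --safe #-}
module Submission where

-- Satisfaction of an mc-atom kX is upward closed in M and depends only on
-- M ∩ X. Hence an M' ⊆ M in T^nd_P(M) makes M satisfy the heads of all
-- clauses of P(M); conversely, if M is a model then M ∩ hset(P(M)) is such
-- an M', because the head set of every clause of P(M) lies in hset(P(M)).

open import Defs
open import Level using (0ℓ)
open import Data.List.Membership.Propositional using (_∈_)
open import Data.List.Relation.Unary.All using (map)
open import Data.Product using (∃; _×_; _,_; proj₁; proj₂)
open import Function.Bundles using (_⇔_; mk⇔)
open import Relation.Unary using (Pred; _⊆_; _∩_)

module _ {At : Set} where

  ⊨ₐ-mono : {M N : Pred At 0ℓ} (A : MCAtom At) → M ⊆ N → M ⊨ₐ A → N ⊨ₐ A
  ⊨ₐ-mono A M⊆N (ys , ys-uniq , ∣ys∣≡k , ys⊆M∩X) =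
    ys , ys-uniq , ∣ys∣≡k , map (λ (y∈X , My) → y∈X , M⊆N My) ys⊆M∩X

  ⊨ₐ-∩ : {M S : Pred At 0ℓ} (A : MCAtom At) →
         (∀ {a} → a ∈ aset A → S a) → M ⊨ₐ A → (M ∩ S) ⊨ₐ A
  ⊨ₐ-∩ A X⊆S (ys , ys-uniq , ∣ys∣≡k , ys⊆M∩X) =
    ys , ys-uniq , ∣ys∣≡k , map (λ (y∈X , My) → y∈X , My , X⊆S y∈X) ys⊆M∩X

  module _ (P : Program At) (M : Pred At 0ℓ) where

    IsModel⇒restriction∈Tnd : IsModel P M → Tnd P M (M ∩ hset (P ⟨ M ⟩))
    IsModel⇒restriction∈Tnd model = proj₂ , heads
      where
      heads : ∀ r → (P ⟨ M ⟩) r → (M ∩ hset (P ⟨ M ⟩)) ⊨ₐ hd r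
      heads r r∈P⟨M⟩@(r∈P , M⊨bd) =
        ⊨ₐ-∩ (hd r) (λ a∈hd → r , r∈P⟨M⟩ , a∈hd) (model r r∈P M⊨bd)

    Tnd-below⇒IsModel : {M' : Pred At 0ℓ} → Tnd P M M' → M' ⊆ M → IsModel P M
    Tnd-below⇒IsModel (_ , heads) M'⊆M r r∈P M⊨bd =
      ⊨ₐ-mono (hd r) M'⊆M (heads r (r∈P , M⊨bd))

theorem1 : {At : Set} (P : Program At) (M : Pred At 0ℓ) →
    IsModel P M ⇔ (∃ λ (M' : Pred At 0ℓ) → Tnd P M M' × M' ⊆ M)
theorem1 P M = mk⇔
  (λ model → M ∩ hset (P ⟨ M ⟩) , IsModel⇒restriction∈Tnd P M model , λ {_} → proj₁)
  (λ (_ , M'∈Tnd , M'⊆M) → Tnd-below⇒IsModel P M M'∈Tnd M'⊆M)
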